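{- For every integer $m\ge 8$, $$\gamma_{\mathrm{sdR}}(P_{m,3})=\begin{cases} m & \text{if } m \text{ is even},\\ m+1 & \text{if } m\text{ is odd}.\end{cases}$$
   Context: For $m\ge3$ and $k\in\mathbb{Z}_m\setminus\{0\}$, the generalized Petersen graph $P_{m,k}$ has vertex set $\{u_i,v_i:i\in\mathbb{Z}_m\}$ and edge set $\{u_iu_{i+1}, v_iv_{i+k}, u_iv_i: i\in\mathbb{Z}_m\}$. $N(u)$ is the open neighborhood, $N[u]=N(u)\cup\{u\}$; for $f:V\to\{ -1,1,2,3\}$, $V_i=f^{ -1}(i)$, $f(S)=\sum_{s\in S}f(s)$. A signed double Roman domination function (SDRDF) is $f:V\to\{ -1,1,2,3\}$ with: (1) every $u\in V_{ -1}$ has a neighbor in $V_3$ or at least two distinct neighbors in $V_2$; (2) every $u\in V_1$ has a neighbor in $V_2\cup V_3$; (3) $f(N[u])\ge1$ for all $u$. $\gamma_{\mathrm{sdR}}(G)$ is the minimum of $f(V)$ over all SDRDFs on $G$. -}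

module Defs where

open import Data.Nat as ℕ using (ℕ; suc; _%_; NonZero)
open import Data.Fin using (Fin; toℕ)
open import Data.Fin.Properties as FinP using ()
open import Data.Integer as ℤ using (ℤ; +_; -[1+_])
open import Data.Sum using (_⊎_; inj₁; inj₂)
open import Data.Product using (Σ; _×_; _,_; ∃; ∃-syntax)
open import Data.Empty using (⊥)
open import Data.List using (List; map; allFin; _++_; foldr)
open import Relation.Nullary using (¬_; Dec; yes; no)
open import Relation.Nullary.Decidable using (_⊎-dec_)
open import Relation.Binary.PropositionalEquality using (_≡_; _≢_)
import Data.Sum.Properties as SumP

-- Vertices of the generalized Petersen graph P_{m,k}:
-- inj₁ i is the outer vertex u_i, inj₂ i is the inner vertex v_i  (i ∈ ℤ_m ≅ Fin m).
Vertex : ℕ → Set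
Vertex m = Fin m ⊎ Fin m

module Petersen (m : ℕ) .{{_ : NonZero m}} (k : ℕ) where

  Adj : Vertex m → Vertex m → Set
  Adj (inj₁ i) (inj₁ j) = (suc (toℕ i)) % m ≡ toℕ j ⊎ (suc (toℕ j)) % m ≡ toℕ i
  Adj (inj₂ i) (inj₂ j) = (toℕ i ℕ.+ k) % m ≡ toℕ j ⊎ (toℕ j ℕ.+ k) % m ≡ toℕ i
  Adj (inj₁ i) (inj₂ j) = i ≡ j
  Adj (inj₂ i) (inj₁ j) = i ≡ j

  adj? : (x y : Vertex m) → Dec (Adj x y)
  adj? (inj₁ i) (inj₁ j) = (suc (toℕ i) % m ℕ.≟ toℕ j) ⊎-dec (suc (toℕ j) % m ℕ.≟ toℕ i)
  adj? (inj₂ i) (inj₂ j) = ((toℕ i ℕ.+ k) % m ℕ.≟ toℕ j) ⊎-dec ((toℕ j ℕ.+ k) % m ℕ.≟ toℕ i)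
  adj? (inj₁ i) (inj₂ j) = i FinP.≟ j
  adj? (inj₂ i) (inj₁ j) = i FinP.≟ j

  vertex? : (x y : Vertex m) → Dec (x ≡ y)
  vertex? = SumP.≡-dec FinP._≟_ FinP._≟_

  vertices : List (Vertex m)
  vertices = map inj₁ (allFin m) ++ map inj₂ (allFin m)

  data Label : Set where
    neg1 one two three : Label

  val : Label → ℤ
  val neg1  = -[1+ 0 ]
  val one   = + 1
  val two   = + 2
  val three = + 3

  sumℤ : List ℤ → ℤ
  sumℤ = foldr ℤ._+_ (+ 0)

  weight : (Vertex m → Label) → ℤ
  weight f = sumℤ (map (λ w → val (f w)) vertices)

  closedSum : (Vertex m → Label) → Vertex m → ℤ
  closedSum f u = sumℤ (map term vertices)
    where
    term : Vertex m → ℤ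
    term w with vertex? w u | adj? u w
    ... | yes _ | _     = val (f w)
    ... | no _  | yes _ = val (f w)
    ... | no _  | no _  = + 0

  record IsSDRDF (f : Vertex m → Label) : Set where
    field
      cond-1 : ∀ u → f u ≡ neg1 →
               (∃[ w ] (Adj u w × f w ≡ three))
               ⊎ (∃[ w ] ∃[ w' ] (w ≢ w' × Adj u w × Adj u w' × f w ≡ two × f w' ≡ two))
      cond1  : ∀ u → f u ≡ one → ∃[ w ] (Adj u w × (f w ≡ two ⊎ f w ≡ three))
      cond3  : ∀ u → + 1 ℤ.≤ closedSum f u

  IsγsdR : ℤ → Set
  IsγsdR g = (Σ (Vertex m → Label) λ f → IsSDRDF f × weight f ≡ g)
           × (∀ f → IsSDRDF f → g ℤ.≤ weight f)

{-# OPTIONS --safe #-}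
module Submission where

-- Lower bound, for every cubic P(m,k), by discharging: a vertex x with label a and neighbour labels
-- b₁, b₂, b₃ gets excess ρ(a)(2 − Σ δ(bᵢ)) + δ(a)(Σ ρ(bᵢ) − 6), where δ marks the label −1 and
-- ρ = 0, 1, 3, 5 on −1, 1, 2, 3. The SDRDF conditions at x make the excess nonnegative (a finite
-- check). Summed over the graph the cross terms cancel by double counting, and 2ρ − 6δ = 4f − 2, so
-- the total excess is 4(f(V) − m); hence f(V) ≥ m. If f(V) = m every excess vanishes, which forces
-- every −1 vertex to have exactly one −1 neighbour and every other vertex exactly two. Counting
-- edges at the −1 vertices then shows that there are exactly m of them, and since they are
-- perfectly matched among themselves, m is even.
--
-- Upper bound for k = 3: labellings given column by column (u_j and v_j together) by explicit
-- patterns that are periodic after a short prefix. Their validity is checked by computation for a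
-- few small m and propagated to all m of the same residue, because inserting one more period into
-- the periodic part does not change the labels any vertex sees around itself.

open import Algebra.Bundles using (AbelianGroup)
open import Data.Bool.Base using (if_then_else_)
open import Data.Empty using (⊥-elim)
open import Data.Fin using (Fin; zero; suc; toℕ)
open import Data.Fin.Patterns using (0F; 1F; 2F)
open import Data.Fin.Permutation using (Permutation; permutation)
import Data.Fin.Properties as FinP
open import Data.Integer as ℤ using (ℤ; +_; -[1+_]; _+_; _*_; _-_; -_)
import Data.Integer.Properties as ℤP
open import Data.Integer.Tactic.RingSolver using (solve-∀)
import Data.List as List
open import Data.List.Properties using (map-++; map-tabulate; map-cong)
open import Data.Nat as ℕ using (ℕ; NonZero; suc; _∸_; _%_; _≤_; _<_; _≤?_; _<?_)
open import Data.Nat.DivMod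
  using (_mod_; m%n<n; m%n%n≡m%n; %-distribˡ-+; [m+n]%n≡m%n; [m+kn]%n≡m%n; m*n%n≡0; m<n⇒m%n≡m; m≤n⇒[n∸m]%m≡n%m)
import Data.Nat.Properties as ℕP
open import Data.Nat.Properties using (allUpTo?)
import Data.Nat.Tactic.RingSolver as ℕ-Solver
open import Data.Product using (∃; ∃₂; _×_; _,_; proj₁; proj₂)
open import Data.Sum as Sum using (_⊎_; inj₁; inj₂)
open import Data.Sum.Properties using (≡-dec; inj₁-injective; inj₂-injective)
open import Data.Unit using (⊤; tt)
open import Data.Vec.Functional using (Vector; _∷_; [])
open import Function.Base using (_∘_; id)
open import Function.Definitions using (Injective)
open import Relation.Binary.Definitions using (DecidableEquality)
open import Relation.Binary.PropositionalEquality
open import Relation.Nullary using (Dec; yes; no; does; ¬?)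
open import Relation.Nullary.Decidable using (_×-dec_; _⊎-dec_; _→-dec_; from-yes)

open import Algebra.Properties.CommutativeSemigroup ℤP.+-commutativeSemigroup using (interchange; x∙yz≈y∙xz)
open import Algebra.Properties.Group (AbelianGroup.group ℤP.+-0-abelianGroup) using (∙-cancelˡ; ∙-cancelʳ)
open import Algebra.Properties.Semiring.Sum ℤP.+-*-semiring
  using (sum-syntax; ∑-distrib-+; ∑-comm; ∑-permute; sum-cong-≗; sum-replicate-zero; *-distribˡ-sum)

open import Defs

infixl 7 _when_

_when_ : {P : Set} → ℤ → Dec P → ℤ
x when p = if does p then x else + 0

when-⇔ : ∀ {P Q : Set} {x} (p : Dec P) (q : Dec Q) → (P → Q) → (Q → P) → x when p ≡ x when q
when-⇔ (yes _) (yes _) _   _   = refl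
when-⇔ (no _)  (no _)  _   _   = refl
when-⇔ (yes a) (no ¬b) P⇒Q _   = ⊥-elim (¬b (P⇒Q a))
when-⇔ (no ¬a) (yes b) _   Q⇒P = ⊥-elim (¬a (Q⇒P b))

∑-const : ∀ n x → ∑[ i < n ] x ≡ + n * x
∑-const ℕ.zero    x = refl
∑-const (ℕ.suc n) x = begin
  x + ∑[ i < n ] x    ≡⟨ cong (_+_ x) (∑-const n x) ⟩
  x + + n * x         ≡⟨ cong (λ t → t + + n * x) (sym (ℤP.*-identityˡ x)) ⟩
  + 1 * x + + n * x   ≡⟨ sym (ℤP.*-distribʳ-+ x (+ 1) (+ n)) ⟩
  + ℕ.suc n * x       ∎
  where open ≡-Reasoning

∑-point : ∀ {n} (F : Vector ℤ n) j → ∑[ i < n ] (F i when (i FinP.≟ j)) ≡ F j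
∑-point {ℕ.suc n} F zero    = trans (cong (_+_ (F zero)) (sum-replicate-zero n)) (ℤP.+-identityʳ (F zero))
∑-point {ℕ.suc n} F (suc j) = trans (ℤP.+-identityˡ _) (∑-point (F ∘ suc) j)

∑-nonneg : ∀ {n} {F : Vector ℤ n} → (∀ i → + 0 ℤ.≤ F i) → + 0 ℤ.≤ ∑[ i < n ] F i
∑-nonneg {ℕ.zero}  _       = ℤP.≤-refl
∑-nonneg {ℕ.suc n} F≥0 = ℤP.+-mono-≤ (F≥0 zero) (∑-nonneg (F≥0 ∘ suc))

term≤∑ : ∀ {n} {F : Vector ℤ n} → (∀ i → + 0 ℤ.≤ F i) → ∀ j → F j ℤ.≤ ∑[ i < n ] F i
term≤∑ {ℕ.suc n} {F} F≥0 zero    = ℤP.i≤i+j (F zero) _ {{ℤ.nonNegative (∑-nonneg (F≥0 ∘ suc))}}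
term≤∑ {ℕ.suc n} {F} F≥0 (suc j) =
  ℤP.≤-trans (term≤∑ (F≥0 ∘ suc) j) (ℤP.i≤j+i _ (F zero) {{ℤ.nonNegative (F≥0 zero)}})

module _ {A : Set} (_≟_ : DecidableEquality A) where

  when-enumerated : ∀ {n} {P : A → Set} (P? : ∀ w → Dec (P w)) (e : Fin n → A) → Injective _≡_ _≡_ e →
                    (∀ {w} → P w → ∃ λ t → e t ≡ w) → (∀ t → P (e t)) →
                    ∀ x w → x when P? w ≡ ∑[ t < n ] (x when (w ≟ e t))
  when-enumerated {n} P? e e-injective enumerates enumerated x w with P? w
  ... | yes Pw = let t₀ , et₀≡w = enumerates Pw in begin
    x                                  ≡⟨ ∑-point (λ _ → x) t₀ ⟨
    ∑[ t < n ] (x when (t FinP.≟ t₀))  ≡⟨ sum-cong-≗ (λ t → when-⇔ (t FinP.≟ t₀) (w ≟ e t)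
                                            (λ { refl → sym et₀≡w })
                                            (λ w≡et → e-injective (trans (sym w≡et) (sym et₀≡w)))) ⟩
    ∑[ t < n ] (x when (w ≟ e t))      ∎
    where open ≡-Reasoning
  ... | no ¬Pw = begin
    + 0                                ≡⟨ sum-replicate-zero n ⟨
    ∑[ t < n ] (+ 0)                   ≡⟨ sum-cong-≗ (λ t → when-⇔ (no λ ()) (w ≟ e t) (λ ())
                                                                 (λ { refl → ¬Pw (enumerated t) })) ⟩
    ∑[ t < n ] (x when (w ≟ e t))      ∎
    where open ≡-Reasoning

sumℤ-++ : ∀ xs ys → List.foldr _+_ (+ 0) (xs List.++ ys) ≡ List.foldr _+_ (+ 0) xs + List.foldr _+_ (+ 0) ys
sumℤ-++ List.[]       ys = sym (ℤP.+-identityˡ _)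
sumℤ-++ (x List.∷ xs) ys = trans (cong (_+_ x) (sumℤ-++ xs ys)) (sym (ℤP.+-assoc x _ _))

sumℤ-tabulate : ∀ {A : Set} {n} (F : A → ℤ) (g : Fin n → A) →
                List.foldr _+_ (+ 0) (List.map F (List.tabulate g)) ≡ ∑[ i < n ] F (g i)
sumℤ-tabulate {n = ℕ.zero}  F g = refl
sumℤ-tabulate {n = ℕ.suc n} F g = cong (_+_ (F (g zero))) (sumℤ-tabulate F (g ∘ suc))

module _ {m : ℕ} where

  ∑V : (Vertex m → ℤ) → ℤ
  ∑V F = ∑[ i < m ] F (inj₁ i) + ∑[ i < m ] F (inj₂ i)

  _≟V_ : DecidableEquality (Vertex m)
  _≟V_ = ≡-dec FinP._≟_ FinP._≟_

  ∑V-cong : ∀ {F G : Vertex m → ℤ} → (∀ x → F x ≡ G x) → ∑V F ≡ ∑V G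
  ∑V-cong F≗G = cong₂ _+_ (sum-cong-≗ (F≗G ∘ inj₁)) (sum-cong-≗ (F≗G ∘ inj₂))

  ∑V-distrib-+ : ∀ (F G : Vertex m → ℤ) → ∑V (λ x → F x + G x) ≡ ∑V F + ∑V G
  ∑V-distrib-+ F G = begin
    ∑V (λ x → F x + G x)
      ≡⟨ cong₂ _+_ (∑-distrib-+ (F ∘ inj₁) (G ∘ inj₁)) (∑-distrib-+ (F ∘ inj₂) (G ∘ inj₂)) ⟩
    (∑[ i < m ] F (inj₁ i) + ∑[ i < m ] G (inj₁ i)) + (∑[ i < m ] F (inj₂ i) + ∑[ i < m ] G (inj₂ i))
      ≡⟨ interchange (∑[ i < m ] F (inj₁ i)) (∑[ i < m ] G (inj₁ i))
                     (∑[ i < m ] F (inj₂ i)) (∑[ i < m ] G (inj₂ i)) ⟩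
    ∑V F + ∑V G ∎
    where open ≡-Reasoning

  ∑V-*ˡ : ∀ c (F : Vertex m → ℤ) → ∑V (λ x → c * F x) ≡ c * ∑V F
  ∑V-*ˡ c F = trans (cong₂ _+_ (sym (*-distribˡ-sum c (F ∘ inj₁))) (sym (*-distribˡ-sum c (F ∘ inj₂))))
                    (sym (ℤP.*-distribˡ-+ c _ _))

  ∑V-const : ∀ c → ∑V (λ _ → c) ≡ + m * c + + m * c
  ∑V-const c = cong₂ _+_ (∑-const m c) (∑-const m c)

  ∑V-nonneg : ∀ {F : Vertex m → ℤ} → (∀ x → + 0 ℤ.≤ F x) → + 0 ℤ.≤ ∑V F
  ∑V-nonneg F≥0 = ℤP.+-mono-≤ (∑-nonneg (F≥0 ∘ inj₁)) (∑-nonneg (F≥0 ∘ inj₂))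

  term≤∑V : ∀ {F : Vertex m → ℤ} → (∀ x → + 0 ℤ.≤ F x) → ∀ x → F x ℤ.≤ ∑V F
  term≤∑V F≥0 (inj₁ i) =
    ℤP.≤-trans (term≤∑ (F≥0 ∘ inj₁) i) (ℤP.i≤i+j _ _ {{ℤ.nonNegative (∑-nonneg (F≥0 ∘ inj₂))}})
  term≤∑V F≥0 (inj₂ i) =
    ℤP.≤-trans (term≤∑ (F≥0 ∘ inj₂) i) (ℤP.i≤j+i _ _ {{ℤ.nonNegative (∑-nonneg (F≥0 ∘ inj₁))}})

  ∑V-point : ∀ (F : Vertex m → ℤ) a → ∑V (λ w → F w when (w ≟V a)) ≡ F a
  ∑V-point F (inj₁ j) = trans (cong₂ _+_ (∑-point (F ∘ inj₁) j) (sum-replicate-zero m))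
                              (ℤP.+-identityʳ (F (inj₁ j)))
  ∑V-point F (inj₂ j) = trans (cong₂ _+_ (sum-replicate-zero m) (∑-point (F ∘ inj₂) j))
                              (ℤP.+-identityˡ (F (inj₂ j)))

  ∑V-∑-comm : ∀ {n} (T : Vertex m → Fin n → ℤ) → ∑V (λ w → ∑[ t < n ] T w t) ≡ ∑[ t < n ] ∑V (λ w → T w t)
  ∑V-∑-comm T = trans (cong₂ _+_ (∑-comm (T ∘ inj₁)) (∑-comm (T ∘ inj₂)))
                      (sym (∑-distrib-+ (λ t → ∑[ i < m ] T (inj₁ i) t) (λ t → ∑[ i < m ] T (inj₂ i) t)))

-- The labels −1, 1, 2, 3 once more, independently of m (column patterns must serve every m), and
-- encoded in Fin 4 so that decidable equality and exhaustive checks come from Fin.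
Lab : Set
Lab = Fin 4

pattern L₋₁ = zero
pattern L₁  = suc zero
pattern L₂  = suc (suc zero)
pattern L₃  = suc (suc (suc zero))

value : Lab → ℤ
value L₋₁ = -[1+ 0 ]
value L₁  = + 1
value L₂  = + 2
value L₃  = + 3

Guarded : Lab → Vector Lab 3 → Set
Guarded L₋₁ nb = (∃ λ t → nb t ≡ L₃) ⊎ (∃₂ λ t t′ → t ≢ t′ × nb t ≡ L₂ × nb t′ ≡ L₂)
Guarded L₁  nb = ∃ λ t → nb t ≡ L₂ ⊎ nb t ≡ L₃
Guarded _   _  = ⊤

LocallyValid : Lab → Vector Lab 3 → Set
LocallyValid a nb = Guarded a nb × + 1 ℤ.≤ value a + ∑[ t < 3 ] value (nb t)

guarded? : ∀ a nb → Dec (Guarded a nb)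
guarded? L₋₁ nb = FinP.any? (λ t → nb t FinP.≟ L₃)
           ⊎-dec FinP.any? (λ t → FinP.any? λ t′ → ¬? (t FinP.≟ t′) ×-dec nb t FinP.≟ L₂ ×-dec nb t′ FinP.≟ L₂)
guarded? L₁  nb = FinP.any? λ t → nb t FinP.≟ L₂ ⊎-dec nb t FinP.≟ L₃
guarded? L₂  nb = yes tt
guarded? L₃  nb = yes tt

locallyValid? : ∀ a nb → Dec (LocallyValid a nb)
locallyValid? a nb = guarded? a nb ×-dec (+ 1 ℤP.≤? value a + ∑[ t < 3 ] value (nb t))

Guarded-resp : ∀ a {nb nb′} → nb ≗ nb′ → Guarded a nb → Guarded a nb′
Guarded-resp L₋₁ nb≗ (inj₁ (t , e))                 = inj₁ (t , trans (sym (nb≗ t)) e)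
Guarded-resp L₋₁ nb≗ (inj₂ (t , t′ , t≢t′ , e , e′)) =
  inj₂ (t , t′ , t≢t′ , trans (sym (nb≗ t)) e , trans (sym (nb≗ t′)) e′)
Guarded-resp L₁  nb≗ (t , e) = t , Sum.map (trans (sym (nb≗ t))) (trans (sym (nb≗ t))) e
Guarded-resp L₂  nb≗ _       = tt
Guarded-resp L₃  nb≗ _       = tt

LocallyValid-resp : ∀ {a nb nb′} → nb ≗ nb′ → LocallyValid a nb → LocallyValid a nb′
LocallyValid-resp {a} nb≗ (guarded , positive) =
  Guarded-resp a nb≗ guarded , subst (λ s → + 1 ℤ.≤ value a + s) (sum-cong-≗ (cong value ∘ nb≗)) positive

deficit : Lab → ℤ
deficit L₋₁ = + 1
deficit _   = + 0

charge : Lab → ℤ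
charge L₋₁ = + 0
charge L₁  = + 1
charge L₂  = + 3
charge L₃  = + 5

excess : Lab → Vector Lab 3 → ℤ
excess a nb = charge a * (+ 2 - ∑[ t < 3 ] deficit (nb t)) + deficit a * (∑[ t < 3 ] charge (nb t) - + 6)

charge-deficit : ∀ a → + 2 * charge a - + 6 * deficit a ≡ + 4 * value a - + 2
charge-deficit L₋₁ = refl
charge-deficit L₁  = refl
charge-deficit L₂  = refl
charge-deficit L₃  = refl

expand : ∀ (nb : Vector Lab 3) → nb ≗ nb 0F ∷ nb 1F ∷ nb 2F ∷ []
expand nb 0F = refl
expand nb 1F = refl
expand nb 2F = refl

deficit-idempotent : ∀ a {n} → deficit a + n ≡ + 2 → deficit a * n ≡ deficit a
deficit-idempotent L₋₁ {n} 1+n≡2 = trans (ℤP.*-identityˡ n) (∙-cancelˡ (+ 1) n (+ 1) 1+n≡2)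
deficit-idempotent L₁  _ = refl
deficit-idempotent L₂  _ = refl
deficit-idempotent L₃  _ = refl

excess-nonneg : ∀ {a nb} → LocallyValid a nb → + 0 ℤ.≤ excess a nb
excess-nonneg {a} {nb} v = check a (nb 0F) (nb 1F) (nb 2F) (LocallyValid-resp (expand nb) v)
  where
  check : ∀ a b c d → LocallyValid a (b ∷ c ∷ d ∷ []) → + 0 ℤ.≤ excess a (b ∷ c ∷ d ∷ [])
  check = from-yes (FinP.all? λ a → FinP.all? λ b → FinP.all? λ c → FinP.all? λ d →
            locallyValid? a (b ∷ c ∷ d ∷ []) →-dec (+ 0 ℤP.≤? excess a (b ∷ c ∷ d ∷ [])))

excess≡0⇒deficits≡2 : ∀ {a nb} → LocallyValid a nb → excess a nb ≡ + 0 →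
                      deficit a + ∑[ t < 3 ] deficit (nb t) ≡ + 2
excess≡0⇒deficits≡2 {a} {nb} v = check a (nb 0F) (nb 1F) (nb 2F) (LocallyValid-resp (expand nb) v)
  where
  check : ∀ a b c d → LocallyValid a (b ∷ c ∷ d ∷ []) → excess a (b ∷ c ∷ d ∷ []) ≡ + 0 →
          deficit a + ∑[ t < 3 ] deficit ((b ∷ c ∷ d ∷ []) t) ≡ + 2
  check = from-yes (FinP.all? λ a → FinP.all? λ b → FinP.all? λ c → FinP.all? λ d →
            locallyValid? a (b ∷ c ∷ d ∷ []) →-dec (excess a (b ∷ c ∷ d ∷ []) ℤ.≟ + 0 →-dec
              (deficit a + ∑[ t < 3 ] deficit ((b ∷ c ∷ d ∷ []) t) ℤ.≟ + 2)))

-- Column j of a pattern holds the labels of u_j and v_j.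
Column : Set
Column = Lab × Lab

columnValue : Column → ℤ
columnValue (a , b) = value a + value b

WindowValid : (c₀ c₊₁ c₋₁ c₊ₖ c₋ₖ : Column) → Set
WindowValid c₀ c₊₁ c₋₁ c₊ₖ c₋ₖ =
  LocallyValid (proj₁ c₀) (proj₁ c₊₁ ∷ proj₁ c₋₁ ∷ proj₂ c₀ ∷ []) ×
  LocallyValid (proj₂ c₀) (proj₂ c₊ₖ ∷ proj₂ c₋ₖ ∷ proj₁ c₀ ∷ [])

ColumnValid : (n : ℕ) .{{_ : NonZero n}} → ℕ → (ℕ → Column) → ℕ → Set
ColumnValid n k c j = WindowValid (c j) (c ((j ℕ.+ 1) % n)) (c ((j ℕ.+ (n ∸ 1)) % n))
                                        (c ((j ℕ.+ k) % n)) (c ((j ℕ.+ (n ∸ k)) % n))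

ValidPattern : (n : ℕ) .{{_ : NonZero n}} → ℕ → (ℕ → Column) → Set
ValidPattern n k c = ∀ {j} → j < n → ColumnValid n k c j

validPattern? : ∀ n .{{_ : NonZero n}} k c → Dec (ValidPattern n k c)
validPattern? n k c = allUpTo? (λ j → locallyValid? _ _ ×-dec locallyValid? _ _) n

∑< : ℕ → (ℕ → ℤ) → ℤ
∑< n F = ∑[ i < n ] F (toℕ i)

∑<-+ : ∀ a b F → ∑< (a ℕ.+ b) F ≡ ∑< a F + ∑< b (λ i → F (a ℕ.+ i))
∑<-+ ℕ.zero    b F = sym (ℤP.+-identityˡ (∑< b F))
∑<-+ (ℕ.suc a) b F = trans (cong (_+_ (F 0)) (∑<-+ a b (F ∘ ℕ.suc))) (sym (ℤP.+-assoc (F 0) _ _))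

module Rotation {m : ℕ} .{{_ : NonZero m}} where

  rotate : ℕ → Fin m → Fin m
  rotate d i = (toℕ i ℕ.+ d) mod m

  toℕ-rotate : ∀ d i → toℕ (rotate d i) ≡ (toℕ i ℕ.+ d) % m
  toℕ-rotate d i = FinP.toℕ-fromℕ< (m%n<n (toℕ i ℕ.+ d) m)

  rotate-rotate : ∀ a b i → rotate a (rotate b i) ≡ rotate (b ℕ.+ a) i
  rotate-rotate a b i = FinP.toℕ-injective (begin
    toℕ (rotate a (rotate b i))              ≡⟨ toℕ-rotate a (rotate b i) ⟩
    (toℕ (rotate b i) ℕ.+ a) % m             ≡⟨ cong (λ t → (t ℕ.+ a) % m) (toℕ-rotate b i) ⟩
    ((toℕ i ℕ.+ b) % m ℕ.+ a) % m            ≡⟨ %-distribˡ-+ ((toℕ i ℕ.+ b) % m) a m ⟩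
    ((toℕ i ℕ.+ b) % m % m ℕ.+ a % m) % m    ≡⟨ cong (λ t → (t ℕ.+ a % m) % m) (m%n%n≡m%n (toℕ i ℕ.+ b) m) ⟩
    ((toℕ i ℕ.+ b) % m ℕ.+ a % m) % m        ≡⟨ %-distribˡ-+ (toℕ i ℕ.+ b) a m ⟨
    (toℕ i ℕ.+ b ℕ.+ a) % m                  ≡⟨ cong (_% m) (ℕP.+-assoc (toℕ i) b a) ⟩
    (toℕ i ℕ.+ (b ℕ.+ a)) % m                ≡⟨ toℕ-rotate (b ℕ.+ a) i ⟨
    toℕ (rotate (b ℕ.+ a) i)                 ∎)
    where open ≡-Reasoning

  rotate-full : ∀ i → rotate m i ≡ i
  rotate-full i = FinP.toℕ-injective (begin
    toℕ (rotate m i)       ≡⟨ toℕ-rotate m i ⟩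
    (toℕ i ℕ.+ m) % m      ≡⟨ [m+n]%n≡m%n (toℕ i) m ⟩
    toℕ i % m              ≡⟨ m<n⇒m%n≡m (FinP.toℕ<n i) ⟩
    toℕ i                  ∎)
    where open ≡-Reasoning

  rotate-inverseˡ : ∀ {d} → d ≤ m → ∀ i → rotate (m ∸ d) (rotate d i) ≡ i
  rotate-inverseˡ {d} d≤m i = trans (rotate-rotate (m ∸ d) d i)
                                   (trans (cong (λ e → rotate e i) (ℕP.m+[n∸m]≡n d≤m)) (rotate-full i))

  rotate-inverseʳ : ∀ {d} → d ≤ m → ∀ i → rotate d (rotate (m ∸ d) i) ≡ i
  rotate-inverseʳ {d} d≤m i = trans (rotate-rotate d (m ∸ d) i)
                                   (trans (cong (λ e → rotate e i) (ℕP.m∸n+n≡m d≤m)) (rotate-full i))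

  rotate-≢ : ∀ {d} → 0 < d → d < m → ∀ i → rotate d i ≢ i
  rotate-≢ {d} 0<d d<m i rotate≡ with toℕ i ℕ.+ d <? m
  ... | yes no-wrap = ℕP.<-irrefl (sym i+d≡i) (ℕP.m<m+n (toℕ i) 0<d)
    where
    i+d≡i : toℕ i ℕ.+ d ≡ toℕ i
    i+d≡i = begin
      toℕ i ℕ.+ d              ≡⟨ m<n⇒m%n≡m no-wrap ⟨
      (toℕ i ℕ.+ d) % m        ≡⟨ toℕ-rotate d i ⟨
      toℕ (rotate d i)         ≡⟨ cong toℕ rotate≡ ⟩
      toℕ i                    ∎
      where open ≡-Reasoning
  ... | no wrap = ℕP.<-irrefl i+d∸m≡i i+d∸m<i
    where
    m≤i+d = ℕP.≮⇒≥ wrap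
    i+d∸m<i : toℕ i ℕ.+ d ∸ m < toℕ i
    i+d∸m<i = begin-strict
      toℕ i ℕ.+ d ∸ m          <⟨ ℕP.∸-monoˡ-< (ℕP.+-monoʳ-< (toℕ i) d<m) m≤i+d ⟩
      toℕ i ℕ.+ m ∸ m          ≡⟨ ℕP.m+n∸n≡m (toℕ i) m ⟩
      toℕ i                    ∎
      where open ℕP.≤-Reasoning
    i+d∸m≡i : toℕ i ℕ.+ d ∸ m ≡ toℕ i
    i+d∸m≡i = begin
      toℕ i ℕ.+ d ∸ m          ≡⟨ m<n⇒m%n≡m (ℕP.<-trans i+d∸m<i (FinP.toℕ<n i)) ⟨
      (toℕ i ℕ.+ d ∸ m) % m    ≡⟨ m≤n⇒[n∸m]%m≡n%m m≤i+d ⟩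
      (toℕ i ℕ.+ d) % m        ≡⟨ toℕ-rotate d i ⟨
      toℕ (rotate d i)         ≡⟨ cong toℕ rotate≡ ⟩
      toℕ i                    ∎
      where open ≡-Reasoning

  rotation : ∀ {d} → d ≤ m → Permutation m m
  rotation {d} d≤m = permutation (rotate d) (rotate (m ∸ d)) (rotate-inverseʳ d≤m) (rotate-inverseˡ d≤m)

  ∑-rotate : ∀ {d} → d ≤ m → (F : Vector ℤ m) → ∑[ i < m ] F (rotate d i) ≡ ∑[ i < m ] F i
  ∑-rotate d≤m F = sym (∑-permute F (rotation d≤m))

+m≡t+t⇒m%2≡0 : ∀ {m} t → + m ≡ t + t → m % 2 ≡ 0
+m≡t+t⇒m%2≡0 {m} (+ n) m≡n+n = begin
  m % 2               ≡⟨ cong (_% 2) (ℤP.+-injective m≡n+n) ⟩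
  (n ℕ.+ n) % 2       ≡⟨ cong (_% 2) (trans (cong (n ℕ.+_) (sym (ℕP.+-identityʳ n))) (ℕP.*-comm 2 n)) ⟩
  (n ℕ.* 2) % 2       ≡⟨ m*n%n≡0 n 2 ⟩
  0                   ∎
  where open ≡-Reasoning
+m≡t+t⇒m%2≡0 -[1+ n ] ()

module Cubic (m k : ℕ) .{{_ : NonZero m}} (1≤k : 1 ≤ k) (2k<m : k ℕ.+ k < m) where

  open Petersen m k
  open Rotation

  private
    1+1<m : 1 ℕ.+ 1 < m
    1+1<m = ℕP.≤-<-trans (ℕP.+-mono-≤ 1≤k 1≤k) 2k<m

    d+d<m⇒d≤m : ∀ {d} → d ℕ.+ d < m → d ≤ m
    d+d<m⇒d≤m {d} 2d<m = ℕP.≤-trans (ℕP.m≤m+n d d) (ℕP.<⇒≤ 2d<m)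

    d+d<m⇒d<m : ∀ {d} → d ℕ.+ d < m → d < m
    d+d<m⇒d<m {d} 2d<m = ℕP.≤-<-trans (ℕP.m≤m+n d d) 2d<m

    rotate≢rotate-back : ∀ {d} → 0 < d → d ℕ.+ d < m → ∀ i → rotate d i ≢ rotate (m ∸ d) i
    rotate≢rotate-back {d} 0<d 2d<m i eq = rotate-≢ (ℕP.<-≤-trans 0<d (ℕP.m≤m+n d d)) 2d<m i (begin
      rotate (d ℕ.+ d) i        ≡⟨ rotate-rotate d d i ⟨
      rotate d (rotate d i)     ≡⟨ cong (rotate d) eq ⟩
      rotate d (rotate (m ∸ d) i) ≡⟨ rotate-inverseʳ (d+d<m⇒d≤m 2d<m) i ⟩
      i                         ∎)
      where open ≡-Reasoning

    rotate-back≢ : ∀ {d} → 0 < d → d < m → ∀ i → rotate (m ∸ d) i ≢ i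
    rotate-back≢ {d} 0<d d<m = rotate-≢ (ℕP.m<n⇒0<n∸m d<m) (ℕP.∸-monoʳ-< 0<d (ℕP.<⇒≤ d<m))

  next prev spoke : Vertex m → Vertex m
  next (inj₁ i) = inj₁ (rotate 1 i)
  next (inj₂ i) = inj₂ (rotate k i)
  prev (inj₁ i) = inj₁ (rotate (m ∸ 1) i)
  prev (inj₂ i) = inj₂ (rotate (m ∸ k) i)
  spoke (inj₁ i) = inj₂ i
  spoke (inj₂ i) = inj₁ i

  nbr : Vertex m → Vector (Vertex m) 3
  nbr x = next x ∷ prev x ∷ spoke x ∷ []

  prev-next : ∀ x → prev (next x) ≡ x
  prev-next (inj₁ i) = cong inj₁ (rotate-inverseˡ (d+d<m⇒d≤m 1+1<m) i)
  prev-next (inj₂ i) = cong inj₂ (rotate-inverseˡ (d+d<m⇒d≤m 2k<m) i)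

  next-prev : ∀ x → next (prev x) ≡ x
  next-prev (inj₁ i) = cong inj₁ (rotate-inverseʳ (d+d<m⇒d≤m 1+1<m) i)
  next-prev (inj₂ i) = cong inj₂ (rotate-inverseʳ (d+d<m⇒d≤m 2k<m) i)

  next≢prev : ∀ x → next x ≢ prev x
  next≢prev (inj₁ i) e = rotate≢rotate-back ℕ.z<s 1+1<m i (inj₁-injective e)
  next≢prev (inj₂ i) e = rotate≢rotate-back 1≤k 2k<m i (inj₂-injective e)

  nbr≢self : ∀ x t → nbr x t ≢ x
  nbr≢self (inj₁ i) 0F e = rotate-≢ ℕ.z<s (d+d<m⇒d<m 1+1<m) i (inj₁-injective e)
  nbr≢self (inj₂ i) 0F e = rotate-≢ 1≤k (d+d<m⇒d<m 2k<m) i (inj₂-injective e)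
  nbr≢self (inj₁ i) 1F e = rotate-back≢ ℕ.z<s (d+d<m⇒d<m 1+1<m) i (inj₁-injective e)
  nbr≢self (inj₂ i) 1F e = rotate-back≢ 1≤k (d+d<m⇒d<m 2k<m) i (inj₂-injective e)
  nbr≢self (inj₁ i) 2F ()
  nbr≢self (inj₂ i) 2F ()

  nbr-injective : ∀ x → Injective _≡_ _≡_ (nbr x)
  nbr-injective x {0F} {0F} _ = refl
  nbr-injective x {0F} {1F} e = ⊥-elim (next≢prev x e)
  nbr-injective x {1F} {0F} e = ⊥-elim (next≢prev x (sym e))
  nbr-injective x {1F} {1F} _ = refl
  nbr-injective x {2F} {2F} _ = refl
  nbr-injective (inj₁ i) {0F} {2F} ()
  nbr-injective (inj₁ i) {1F} {2F} ()
  nbr-injective (inj₁ i) {2F} {0F} ()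
  nbr-injective (inj₁ i) {2F} {1F} ()
  nbr-injective (inj₂ i) {0F} {2F} ()
  nbr-injective (inj₂ i) {1F} {2F} ()
  nbr-injective (inj₂ i) {2F} {0F} ()
  nbr-injective (inj₂ i) {2F} {1F} ()

  private
    toℕ-rotate-suc : ∀ i → toℕ (rotate 1 i) ≡ ℕ.suc (toℕ i) % m
    toℕ-rotate-suc i = trans (toℕ-rotate 1 i) (cong (_% m) (ℕP.+-comm (toℕ i) 1))

    rotate-back : ∀ {d i j} → d ≤ m → rotate d j ≡ i → j ≡ rotate (m ∸ d) i
    rotate-back {d} {i} {j} d≤m e = trans (sym (rotate-inverseˡ d≤m j)) (cong (rotate (m ∸ d)) e)

  Adj⇒nbr : ∀ {x w} → Adj x w → ∃ λ t → nbr x t ≡ w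
  Adj⇒nbr {inj₁ i} {inj₁ j} (inj₁ e) = 0F , cong inj₁ (FinP.toℕ-injective (trans (toℕ-rotate-suc i) e))
  Adj⇒nbr {inj₁ i} {inj₁ j} (inj₂ e) = 1F , cong inj₁ (sym (rotate-back (d+d<m⇒d≤m 1+1<m)
                                         (FinP.toℕ-injective (trans (toℕ-rotate-suc j) e))))
  Adj⇒nbr {inj₂ i} {inj₂ j} (inj₁ e) = 0F , cong inj₂ (FinP.toℕ-injective (trans (toℕ-rotate k i) e))
  Adj⇒nbr {inj₂ i} {inj₂ j} (inj₂ e) = 1F , cong inj₂ (sym (rotate-back (d+d<m⇒d≤m 2k<m)
                                         (FinP.toℕ-injective (trans (toℕ-rotate k j) e))))
  Adj⇒nbr {inj₁ i} {inj₂ j} e        = 2F , cong inj₂ e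
  Adj⇒nbr {inj₂ i} {inj₁ j} e        = 2F , cong inj₁ e

  nbr⇒Adj : ∀ x t → Adj x (nbr x t)
  nbr⇒Adj (inj₁ i) 0F = inj₁ (sym (toℕ-rotate-suc i))
  nbr⇒Adj (inj₂ i) 0F = inj₁ (sym (toℕ-rotate k i))
  nbr⇒Adj (inj₁ i) 1F = inj₂ (trans (sym (toℕ-rotate-suc _)) (cong toℕ (rotate-inverseʳ (d+d<m⇒d≤m 1+1<m) i)))
  nbr⇒Adj (inj₂ i) 1F = inj₂ (trans (sym (toℕ-rotate k _)) (cong toℕ (rotate-inverseʳ (d+d<m⇒d≤m 2k<m) i)))
  nbr⇒Adj (inj₁ i) 2F = refl
  nbr⇒Adj (inj₂ i) 2F = refl

  closedNbr : Vertex m → Vector (Vertex m) 4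
  closedNbr x = x ∷ nbr x

  closedNbr-injective : ∀ x → Injective _≡_ _≡_ (closedNbr x)
  closedNbr-injective x {zero}  {zero}   _ = refl
  closedNbr-injective x {zero}  {suc t}  e = ⊥-elim (nbr≢self x t (sym e))
  closedNbr-injective x {suc t} {zero}   e = ⊥-elim (nbr≢self x t e)
  closedNbr-injective x {suc t} {suc t′} e = cong suc (nbr-injective x e)

  ∑N : (Vertex m → ℤ) → Vertex m → ℤ
  ∑N h x = ∑[ t < 3 ] h (nbr x t)

  sumℤ-vertices : ∀ F → sumℤ (List.map F vertices) ≡ ∑V F
  sumℤ-vertices F = begin
    sumℤ (List.map F (List.map inj₁ (List.allFin m) List.++ List.map inj₂ (List.allFin m)))
      ≡⟨ cong sumℤ (map-++ F (List.map inj₁ (List.allFin m)) _) ⟩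
    sumℤ (List.map F (List.map inj₁ (List.allFin m)) List.++ List.map F (List.map inj₂ (List.allFin m)))
      ≡⟨ sumℤ-++ (List.map F (List.map inj₁ (List.allFin m))) _ ⟩
    sumℤ (List.map F (List.map inj₁ (List.allFin m))) + sumℤ (List.map F (List.map inj₂ (List.allFin m)))
      ≡⟨ cong₂ _+_ (side inj₁) (side inj₂) ⟩
    ∑V F ∎
    where
    open ≡-Reasoning
    side : (h : Fin m → Vertex m) → sumℤ (List.map F (List.map h (List.allFin m))) ≡ ∑[ i < m ] F (h i)
    side h = trans (cong (sumℤ ∘ List.map F) (map-tabulate id h)) (sumℤ-tabulate F h)

  weight≡ : ∀ f → weight f ≡ ∑V (val ∘ f)
  weight≡ f = sumℤ-vertices (val ∘ f)

  -- The summand of closedSum is local to its definition, so the left-hand side is left for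
  -- unification with the use in closedSum≡, which precedes the clauses.
  closedSum-summand : ∀ f u w → _ ≡ val (f w) when (vertex? w u ⊎-dec adj? u w)

  closedSum≡ : ∀ f u → closedSum f u ≡ val (f u) + ∑N (val ∘ f) u
  closedSum≡ f u = begin
    closedSum f u
      ≡⟨ cong sumℤ (map-cong (closedSum-summand f u) vertices) ⟩
    sumℤ (List.map (λ w → val (f w) when (vertex? w u ⊎-dec adj? u w)) vertices)
      ≡⟨ sumℤ-vertices _ ⟩
    ∑V (λ w → val (f w) when (vertex? w u ⊎-dec adj? u w))
      ≡⟨ ∑V-cong (λ w → when-enumerated _≟V_ (λ w → vertex? w u ⊎-dec adj? u w) (closedNbr u)
                          (closedNbr-injective u) enumerate enumerated (val (f w)) w) ⟩
    ∑V (λ w → ∑[ t < 4 ] (val (f w) when (w ≟V closedNbr u t)))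
      ≡⟨ ∑V-∑-comm (λ w t → val (f w) when (w ≟V closedNbr u t)) ⟩
    ∑[ t < 4 ] ∑V (λ w → val (f w) when (w ≟V closedNbr u t))
      ≡⟨ sum-cong-≗ (λ t → ∑V-point (val ∘ f) (closedNbr u t)) ⟩
    val (f u) + ∑N (val ∘ f) u ∎
    where
    open ≡-Reasoning
    enumerate : ∀ {w} → w ≡ u ⊎ Adj u w → ∃ λ t → closedNbr u t ≡ w
    enumerate (inj₁ refl) = zero , refl
    enumerate (inj₂ adj)  = let t , e = Adj⇒nbr adj in suc t , e
    enumerated : ∀ t → closedNbr u t ≡ u ⊎ Adj u (closedNbr u t)
    enumerated zero    = inj₁ refl
    enumerated (suc t) = inj₂ (nbr⇒Adj u t)

  closedSum-summand f u w with vertex? w u | adj? u w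
  ... | yes _ | _     = refl
  ... | no _  | yes _ = refl
  ... | no _  | no _  = refl

  ∑V-∘next : ∀ (G : Vertex m → ℤ) → ∑V (G ∘ next) ≡ ∑V G
  ∑V-∘next G = cong₂ _+_ (∑-rotate (d+d<m⇒d≤m 1+1<m) (G ∘ inj₁)) (∑-rotate (d+d<m⇒d≤m 2k<m) (G ∘ inj₂))

  ∑V-∘prev : ∀ (G : Vertex m → ℤ) → ∑V (G ∘ prev) ≡ ∑V G
  ∑V-∘prev G = cong₂ _+_ (∑-rotate (ℕP.m∸n≤m m 1) (G ∘ inj₁)) (∑-rotate (ℕP.m∸n≤m m k) (G ∘ inj₂))

  ∑V-∘spoke : ∀ (G : Vertex m → ℤ) → ∑V (G ∘ spoke) ≡ ∑V G
  ∑V-∘spoke G = ℤP.+-comm (∑[ i < m ] G (inj₂ i)) (∑[ i < m ] G (inj₁ i))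

  private
    reindex : ∀ {σ τ : Vertex m → Vertex m} → (∀ G → ∑V (G ∘ τ) ≡ ∑V G) → (∀ x → σ (τ x) ≡ x) →
               ∀ (p q : Vertex m → ℤ) → ∑V (λ x → p x * q (σ x)) ≡ ∑V (λ x → q x * p (τ x))
    reindex {σ} {τ} ∑V-∘τ στ p q = begin
      ∑V (λ x → p x * q (σ x))              ≡⟨ ∑V-∘τ (λ x → p x * q (σ x)) ⟨
      ∑V (λ x → p (τ x) * q (σ (τ x)))      ≡⟨ ∑V-cong (λ x → trans (cong (λ y → p (τ x) * q y) (στ x))
                                                                    (ℤP.*-comm (p (τ x)) (q x))) ⟩
      ∑V (λ x → q x * p (τ x))              ∎
      where open ≡-Reasoning

  ∑V-next : ∀ (p q : Vertex m → ℤ) → ∑V (λ x → p x * q (next x)) ≡ ∑V (λ x → q x * p (prev x))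
  ∑V-next = reindex {next} {prev} ∑V-∘prev next-prev

  ∑V-prev : ∀ (p q : Vertex m → ℤ) → ∑V (λ x → p x * q (prev x)) ≡ ∑V (λ x → q x * p (next x))
  ∑V-prev = reindex {prev} {next} ∑V-∘next prev-next

  ∑V-spoke : ∀ (p q : Vertex m → ℤ) → ∑V (λ x → p x * q (spoke x)) ≡ ∑V (λ x → q x * p (spoke x))
  ∑V-spoke = reindex {spoke} {spoke} ∑V-∘spoke λ { (inj₁ i) → refl ; (inj₂ i) → refl }

  ∑V-*∑N : ∀ (p q : Vertex m → ℤ) → ∑V (λ x → p x * ∑N q x) ≡
                 ∑V (λ x → p x * q (next x)) + ∑V (λ x → p x * q (prev x)) + ∑V (λ x → p x * q (spoke x))
  ∑V-*∑N p q = begin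
    ∑V (λ x → p x * ∑N q x)
      ≡⟨ ∑V-cong (λ x → expand-product (p x) (q (next x)) (q (prev x)) (q (spoke x))) ⟩
    ∑V (λ x → p x * q (next x) + p x * q (prev x) + p x * q (spoke x))
      ≡⟨ ∑V-distrib-+ (λ x → p x * q (next x) + p x * q (prev x)) (λ x → p x * q (spoke x)) ⟩
    ∑V (λ x → p x * q (next x) + p x * q (prev x)) + ∑V (λ x → p x * q (spoke x))
      ≡⟨ cong (λ s → s + ∑V (λ x → p x * q (spoke x)))
              (∑V-distrib-+ (λ x → p x * q (next x)) (λ x → p x * q (prev x))) ⟩
    ∑V (λ x → p x * q (next x)) + ∑V (λ x → p x * q (prev x)) + ∑V (λ x → p x * q (spoke x)) ∎
    where
    open ≡-Reasoning
    expand-product : ∀ a b c d → a * (b + (c + (d + + 0))) ≡ a * b + a * c + a * d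
    expand-product = solve-∀

  handshake : ∀ (p q : Vertex m → ℤ) → ∑V (λ x → p x * ∑N q x) ≡ ∑V (λ x → q x * ∑N p x)
  handshake p q = begin
    ∑V (λ x → p x * ∑N q x)
      ≡⟨ ∑V-*∑N p q ⟩
    ∑V (λ x → p x * q (next x)) + ∑V (λ x → p x * q (prev x)) + ∑V (λ x → p x * q (spoke x))
      ≡⟨ cong₂ _+_ (cong₂ _+_ (∑V-next p q) (∑V-prev p q)) (∑V-spoke p q) ⟩
    ∑V (λ x → q x * p (prev x)) + ∑V (λ x → q x * p (next x)) + ∑V (λ x → q x * p (spoke x))
      ≡⟨ cong (λ s → s + ∑V (λ x → q x * p (spoke x))) (ℤP.+-comm (∑V (λ x → q x * p (prev x))) _) ⟩
    ∑V (λ x → q x * p (next x)) + ∑V (λ x → q x * p (prev x)) + ∑V (λ x → q x * p (spoke x))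
      ≡⟨ ∑V-*∑N q p ⟨
    ∑V (λ x → q x * ∑N p x) ∎
    where open ≡-Reasoning

  ∑V-*∑N-self-even : ∀ (p : Vertex m → ℤ) → ∃ λ t → ∑V (λ x → p x * ∑N p x) ≡ t + t
  ∑V-*∑N-self-even p = A + S , (begin
    ∑V (λ x → p x * ∑N p x)
      ≡⟨ ∑V-*∑N p p ⟩
    A + ∑V (λ x → p x * p (prev x)) + ∑V (λ x → p x * p (spoke x))
      ≡⟨ cong₂ (λ b c → A + b + c) (∑V-prev p p) spokes ⟩
    A + A + (S + S)
      ≡⟨ regroup A S ⟩
    (A + S) + (A + S) ∎)
    where
    open ≡-Reasoning
    A = ∑V (λ x → p x * p (next x))
    S = ∑[ i < m ] (p (inj₁ i) * p (inj₂ i))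
    spokes : ∑V (λ x → p x * p (spoke x)) ≡ S + S
    spokes = cong (_+_ S) (sum-cong-≗ (λ i → ℤP.*-comm (p (inj₂ i)) (p (inj₁ i))))
    regroup : ∀ a s → a + a + (s + s) ≡ (a + s) + (a + s)
    regroup = solve-∀

  toLab : Label → Lab
  toLab neg1  = L₋₁
  toLab one   = L₁
  toLab two   = L₂
  toLab three = L₃

  fromLab : Lab → Label
  fromLab L₋₁ = neg1
  fromLab L₁  = one
  fromLab L₂  = two
  fromLab L₃  = three

  toLab-fromLab : ∀ a → toLab (fromLab a) ≡ a
  toLab-fromLab L₋₁ = refl
  toLab-fromLab L₁  = refl
  toLab-fromLab L₂  = refl
  toLab-fromLab L₃  = refl

  val-toLab : ∀ a → value (toLab a) ≡ val a
  val-toLab neg1  = refl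
  val-toLab one   = refl
  val-toLab two   = refl
  val-toLab three = refl

  val-fromLab : ∀ a → val (fromLab a) ≡ value a
  val-fromLab L₋₁ = refl
  val-fromLab L₁  = refl
  val-fromLab L₂  = refl
  val-fromLab L₃  = refl

  IsSDRDF⇒locallyValid : ∀ {f} → IsSDRDF f → ∀ x → LocallyValid (toLab (f x)) (toLab ∘ f ∘ nbr x)
  IsSDRDF⇒locallyValid {f} sdrdf x = guarded , subst (+ 1 ℤ.≤_) closedSum≡values (cond3 x)
    where
    open IsSDRDF sdrdf
    closedSum≡values : closedSum f x ≡ value (toLab (f x)) + ∑[ t < 3 ] value (toLab (f (nbr x t)))
    closedSum≡values = trans (closedSum≡ f x)
                             (sym (cong₂ _+_ (val-toLab (f x)) (sum-cong-≗ (val-toLab ∘ f ∘ nbr x))))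
    labelled : ∀ t {w ℓ} → nbr x t ≡ w → f w ≡ ℓ → toLab (f (nbr x t)) ≡ toLab ℓ
    labelled _ nbr≡w fw≡ℓ = cong toLab (trans (cong f nbr≡w) fw≡ℓ)
    distinct : ∀ {t t′ w w′} → nbr x t ≡ w → nbr x t′ ≡ w′ → w ≢ w′ → t ≢ t′
    distinct nbr≡w nbr≡w′ w≢w′ refl = w≢w′ (trans (sym nbr≡w) nbr≡w′)
    guarded : Guarded (toLab (f x)) (toLab ∘ f ∘ nbr x)
    guarded with f x in fx
    ... | neg1  = Sum.map
      (λ (w , adj , fw≡3) → let t , nbr≡w = Adj⇒nbr adj in t , labelled t nbr≡w fw≡3)
      (λ (w , w′ , w≢w′ , adj , adj′ , fw≡2 , fw′≡2) →
         let t , nbr≡w = Adj⇒nbr adj ; t′ , nbr≡w′ = Adj⇒nbr adj′ in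
         t , t′ , distinct nbr≡w nbr≡w′ w≢w′ , labelled t nbr≡w fw≡2 , labelled t′ nbr≡w′ fw′≡2)
      (cond-1 x fx)
    ... | one   = let w , adj , fw≡2∨3 = cond1 x fx ; t , nbr≡w = Adj⇒nbr adj in
                  t , Sum.map (labelled t nbr≡w) (labelled t nbr≡w) fw≡2∨3
    ... | two   = tt
    ... | three = tt

  locallyValid⇒IsSDRDF : ∀ {g} → (∀ x → LocallyValid (g x) (g ∘ nbr x)) → IsSDRDF (fromLab ∘ g)
  locallyValid⇒IsSDRDF {g} valid = record
    { cond-1 = λ u fu≡-1 → Sum.map
        (λ (t , e₃) → nbr u t , nbr⇒Adj u t , cong fromLab e₃)
        (λ (t , t′ , t≢t′ , e₂ , e₂′) → nbr u t , nbr u t′ , t≢t′ ∘ nbr-injective u ,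
                                         nbr⇒Adj u t , nbr⇒Adj u t′ , cong fromLab e₂ , cong fromLab e₂′)
        (guarded fu≡-1)
    ; cond1  = λ u fu≡1 → let t , e₂∨₃ = guarded fu≡1 in
                           nbr u t , nbr⇒Adj u t , Sum.map (cong fromLab) (cong fromLab) e₂∨₃
    ; cond3  = λ u → subst (+ 1 ℤ.≤_) (sym (closedSum≡values u)) (proj₂ (valid u))
    }
    where
    guarded : ∀ {u ℓ} → fromLab (g u) ≡ ℓ → Guarded (toLab ℓ) (g ∘ nbr u)
    guarded {u} e = subst (λ a → Guarded a (g ∘ nbr u)) (trans (sym (toLab-fromLab (g u))) (cong toLab e))
                          (proj₁ (valid u))
    closedSum≡values : ∀ u → closedSum (fromLab ∘ g) u ≡ value (g u) + ∑[ t < 3 ] value (g (nbr u t))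
    closedSum≡values u = trans (closedSum≡ (fromLab ∘ g) u)
                               (cong₂ _+_ (val-fromLab (g u)) (sum-cong-≗ (val-fromLab ∘ g ∘ nbr u)))

  -- The lower bound by discharging

  module LowerBound {g : Vertex m → Lab} (valid : ∀ x → LocallyValid (g x) (g ∘ nbr x)) where

    δ ρ excessAt : Vertex m → ℤ
    δ = deficit ∘ g
    ρ = charge ∘ g
    excessAt x = excess (g x) (g ∘ nbr x)

    ∑-excess : ∑V excessAt ≡ + 4 * (∑V (value ∘ g) - + m)
    ∑-excess = ∙-cancelʳ (∑V (λ x → ρ x * ∑N δ x)) _ _ (begin
      ∑V excessAt + ∑V (λ x → ρ x * ∑N δ x)
        ≡⟨ ∑V-distrib-+ excessAt (λ x → ρ x * ∑N δ x) ⟨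
      ∑V (λ x → excessAt x + ρ x * ∑N δ x)
        ≡⟨ ∑V-cong moved ⟩
      ∑V (λ x → (+ 4 * value (g x) - + 2) + δ x * ∑N ρ x)
        ≡⟨ ∑V-distrib-+ (λ x → + 4 * value (g x) - + 2) (λ x → δ x * ∑N ρ x) ⟩
      ∑V (λ x → + 4 * value (g x) - + 2) + ∑V (λ x → δ x * ∑N ρ x)
        ≡⟨ cong₂ _+_ total (handshake δ ρ) ⟩
      + 4 * (∑V (value ∘ g) - + m) + ∑V (λ x → ρ x * ∑N δ x) ∎)
      where
      open ≡-Reasoning
      rearrange : ∀ c d D P → c * (+ 2 - D) + d * (P - + 6) + c * D ≡ (+ 2 * c - + 6 * d) + d * P
      rearrange = solve-∀
      moved : ∀ x → excessAt x + ρ x * ∑N δ x ≡ (+ 4 * value (g x) - + 2) + δ x * ∑N ρ x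
      moved x = trans (rearrange (ρ x) (δ x) (∑N δ x) (∑N ρ x))
                      (cong (λ s → s + δ x * ∑N ρ x) (charge-deficit (g x)))
      factor : ∀ W M → + 4 * W + (M * - + 2 + M * - + 2) ≡ + 4 * (W - M)
      factor = solve-∀
      total : ∑V (λ x → + 4 * value (g x) - + 2) ≡ + 4 * (∑V (value ∘ g) - + m)
      total = begin
        ∑V (λ x → + 4 * value (g x) - + 2)
          ≡⟨ ∑V-distrib-+ {m} (λ x → + 4 * value (g x)) (λ _ → - + 2) ⟩
        ∑V (λ x → + 4 * value (g x)) + ∑V {m} (λ _ → - + 2)
          ≡⟨ cong₂ _+_ (∑V-*ˡ (+ 4) (value ∘ g)) (∑V-const {m} (- + 2)) ⟩
        + 4 * ∑V (value ∘ g) + (+ m * - + 2 + + m * - + 2)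
          ≡⟨ factor (∑V (value ∘ g)) (+ m) ⟩
        + 4 * (∑V (value ∘ g) - + m) ∎

    excessAt-nonneg : ∀ x → + 0 ℤ.≤ excessAt x
    excessAt-nonneg x = excess-nonneg (valid x)

    total-≥ : + m ℤ.≤ ∑V (value ∘ g)
    total-≥ = ℤP.0≤i-j⇒j≤i (ℤP.*-cancelˡ-≤-pos (+ 0) _ (+ 4)
                (subst (+ 0 ℤ.≤_) ∑-excess (∑V-nonneg excessAt-nonneg)))

    module _ (total≡m : ∑V (value ∘ g) ≡ + m) where

      excessAt≡0 : ∀ x → excessAt x ≡ + 0
      excessAt≡0 x = ℤP.≤-antisym (ℤP.≤-trans (term≤∑V excessAt-nonneg x) (ℤP.≤-reflexive ∑-excess≡0))
                                  (excessAt-nonneg x)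
        where
        ∑-excess≡0 : ∑V excessAt ≡ + 0
        ∑-excess≡0 = trans ∑-excess (trans (cong (λ w → + 4 * (w - + m)) total≡m)
                                           (cong (_*_ (+ 4)) (ℤP.+-inverseʳ (+ m))))

      deficits≡2 : ∀ x → δ x + ∑N δ x ≡ + 2
      deficits≡2 x = excess≡0⇒deficits≡2 (valid x) (excessAt≡0 x)

      ∑δ≡m : ∑V δ ≡ + m
      ∑δ≡m = ℤP.*-cancelˡ-≡ (+ 4) (∑V δ) (+ m) (begin
        + 4 * ∑V δ               ≡⟨ split (∑V δ) ⟩
        ∑V δ + + 3 * ∑V δ        ≡⟨ cong (_+_ (∑V δ)) degree ⟨
        ∑V δ + ∑V (∑N δ)         ≡⟨ ∑V-distrib-+ δ (∑N δ) ⟨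
        ∑V (λ x → δ x + ∑N δ x)  ≡⟨ ∑V-cong deficits≡2 ⟩
        ∑V {m} (λ _ → + 2)       ≡⟨ ∑V-const {m} (+ 2) ⟩
        + m * + 2 + + m * + 2    ≡⟨ double (+ m) ⟩
        + 4 * + m                ∎)
        where
        open ≡-Reasoning
        split : ∀ a → + 4 * a ≡ a + + 3 * a
        split = solve-∀
        double : ∀ a → a * + 2 + a * + 2 ≡ + 4 * a
        double = solve-∀
        degree : ∑V (∑N δ) ≡ + 3 * ∑V δ
        degree = begin
          ∑V (∑N δ)                ≡⟨ ∑V-cong (λ x → ℤP.*-identityˡ (∑N δ x)) ⟨
          ∑V (λ x → + 1 * ∑N δ x)  ≡⟨ handshake (λ _ → + 1) δ ⟩
          ∑V (λ x → δ x * + 3)     ≡⟨ ∑V-cong (λ x → ℤP.*-comm (δ x) (+ 3)) ⟩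
          ∑V (λ x → + 3 * δ x)     ≡⟨ ∑V-*ˡ (+ 3) δ ⟩
          + 3 * ∑V δ               ∎

      m-even : m % 2 ≡ 0
      m-even = let t , ∑δ∑Nδ≡t+t = ∑V-*∑N-self-even δ in +m≡t+t⇒m%2≡0 t (begin
        + m                      ≡⟨ ∑δ≡m ⟨
        ∑V δ                     ≡⟨ ∑V-cong (λ x → deficit-idempotent (g x) (deficits≡2 x)) ⟨
        ∑V (λ x → δ x * ∑N δ x)  ≡⟨ ∑δ∑Nδ≡t+t ⟩
        t + t                    ∎)
        where open ≡-Reasoning

  weight≡values : ∀ f → weight f ≡ ∑V (value ∘ toLab ∘ f)
  weight≡values f = trans (weight≡ f) (∑V-cong (sym ∘ val-toLab ∘ f))

  weight-≥ : ∀ {f} → IsSDRDF f → + m ℤ.≤ weight f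
  weight-≥ {f} sdrdf =
    subst (+ m ℤ.≤_) (sym (weight≡values f)) (LowerBound.total-≥ (IsSDRDF⇒locallyValid sdrdf))

  weight-≥-odd : ∀ {f} → IsSDRDF f → m % 2 ≡ 1 → + ℕ.suc m ℤ.≤ weight f
  weight-≥-odd {f} sdrdf m-odd = ℤP.i<j⇒suc[i]≤j (ℤP.≤∧≢⇒< (weight-≥ sdrdf) m≢weight)
    where
    m≢weight : + m ≢ weight f
    m≢weight m≡weight = ℕP.0≢1+n (trans (sym (LowerBound.m-even (IsSDRDF⇒locallyValid sdrdf)
                                                  (trans (sym (weight≡values f)) (sym m≡weight)))) m-odd)

  colouring : (ℕ → Column) → Vertex m → Lab
  colouring c (inj₁ i) = proj₁ (c (toℕ i))
  colouring c (inj₂ i) = proj₂ (c (toℕ i))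

  module _ {c : ℕ → Column} (valid : ValidPattern m k c) where

    colouring-locallyValid : ∀ x → LocallyValid (colouring c x) (colouring c ∘ nbr x)
    colouring-locallyValid (inj₁ i) = LocallyValid-resp window (proj₁ (valid (FinP.toℕ<n i)))
      where
      window : proj₁ (c ((toℕ i ℕ.+ 1) % m)) ∷ proj₁ (c ((toℕ i ℕ.+ (m ∸ 1)) % m)) ∷ proj₂ (c (toℕ i)) ∷ []
               ≗ colouring c ∘ nbr (inj₁ i)
      window 0F = cong (proj₁ ∘ c) (sym (toℕ-rotate 1 i))
      window 1F = cong (proj₁ ∘ c) (sym (toℕ-rotate (m ∸ 1) i))
      window 2F = refl
    colouring-locallyValid (inj₂ i) = LocallyValid-resp window (proj₂ (valid (FinP.toℕ<n i)))
      where
      window : proj₂ (c ((toℕ i ℕ.+ k) % m)) ∷ proj₂ (c ((toℕ i ℕ.+ (m ∸ k)) % m)) ∷ proj₁ (c (toℕ i)) ∷ []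
               ≗ colouring c ∘ nbr (inj₂ i)
      window 0F = cong (proj₂ ∘ c) (sym (toℕ-rotate k i))
      window 1F = cong (proj₂ ∘ c) (sym (toℕ-rotate (m ∸ k) i))
      window 2F = refl

    colouring-SDRDF : IsSDRDF (fromLab ∘ colouring c)
    colouring-SDRDF = locallyValid⇒IsSDRDF colouring-locallyValid

    weight-colouring : weight (fromLab ∘ colouring c) ≡ ∑< m (columnValue ∘ c)
    weight-colouring = begin
      weight (fromLab ∘ colouring c)        ≡⟨ weight≡ (fromLab ∘ colouring c) ⟩
      ∑V (val ∘ fromLab ∘ colouring c)      ≡⟨ ∑V-cong (val-fromLab ∘ colouring c) ⟩
      ∑V (value ∘ colouring c)              ≡⟨ ∑-distrib-+ {m} (value ∘ proj₁ ∘ c ∘ toℕ)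
                                                                (value ∘ proj₂ ∘ c ∘ toℕ) ⟨
      ∑< m (columnValue ∘ c)                ∎
      where open ≡-Reasoning

  IsγsdR-from : ∀ {c w} → ValidPattern m k c → ∑< m (columnValue ∘ c) ≡ + w →
                (∀ {f} → IsSDRDF f → + w ℤ.≤ weight f) → IsγsdR (+ w)
  IsγsdR-from {c} valid total lower =
    (fromLab ∘ colouring c , colouring-SDRDF valid , trans (weight-colouring valid) total) , λ _ → lower

-- Periodic extension of column patterns

nonZero-+ : ∀ a {b} .{{_ : NonZero b}} → NonZero (a ℕ.+ b)
nonZero-+ a {b} = ℕ.>-nonZero (ℕP.<-≤-trans (ℕ.>-nonZero⁻¹ b) (ℕP.m≤n+m b a))

module _ {n : ℕ} .{{_ : NonZero n}} where

  %-wrap : ∀ {x} → n ≤ x → x < n ℕ.+ n → x % n ≡ x ∸ n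
  %-wrap {x} n≤x x<2n = trans (sym (m≤n⇒[n∸m]%m≡n%m n≤x)) (m<n⇒m%n≡m (ℕP.m<n+o⇒m∸n<o x n x<2n))

  %-back-wrap : ∀ {d j} → d ≤ j → j < n → d ≤ n → (j ℕ.+ (n ∸ d)) % n ≡ j ∸ d
  %-back-wrap {d} {j} d≤j j<n d≤n = begin
    (j ℕ.+ (n ∸ d)) % n                 ≡⟨ cong (λ i → (i ℕ.+ (n ∸ d)) % n) (ℕP.m∸n+n≡m d≤j) ⟨
    (j ∸ d ℕ.+ d ℕ.+ (n ∸ d)) % n       ≡⟨ cong (_% n) (ℕP.+-assoc (j ∸ d) d (n ∸ d)) ⟩
    (j ∸ d ℕ.+ (d ℕ.+ (n ∸ d))) % n     ≡⟨ cong (λ i → (j ∸ d ℕ.+ i) % n) (ℕP.m+[n∸m]≡n d≤n) ⟩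
    (j ∸ d ℕ.+ n) % n                   ≡⟨ [m+n]%n≡m%n (j ∸ d) n ⟩
    (j ∸ d) % n                         ≡⟨ m<n⇒m%n≡m (ℕP.≤-<-trans (ℕP.m∸n≤m j d) j<n) ⟩
    j ∸ d                               ∎
    where open ≡-Reasoning

  %-back-small : ∀ {d j} → j < d → d ≤ n → (j ℕ.+ (n ∸ d)) % n ≡ j ℕ.+ (n ∸ d)
  %-back-small {d} {j} j<d d≤n =
    m<n⇒m%n≡m (ℕP.<-≤-trans (ℕP.+-monoˡ-< (n ∸ d) j<d) (ℕP.≤-reflexive (ℕP.m+[n∸m]≡n d≤n)))

WindowValid-≡ : ∀ {c₀ c₊₁ c₋₁ c₊ₖ c₋ₖ d₀ d₊₁ d₋₁ d₊ₖ d₋ₖ} →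
                c₀ ≡ d₀ → c₊₁ ≡ d₊₁ → c₋₁ ≡ d₋₁ → c₊ₖ ≡ d₊ₖ → c₋ₖ ≡ d₋ₖ →
                WindowValid d₀ d₊₁ d₋₁ d₊ₖ d₋ₖ → WindowValid c₀ c₊₁ c₋₁ c₊ₖ c₋ₖ
WindowValid-≡ refl refl refl refl refl valid = valid

module Periodic (c : ℕ → Column) (p g : ℕ) (periodic : ∀ x → g ≤ x → c (p ℕ.+ x) ≡ c x) where

  module _ {k m} .{{_ : NonZero m}} (1≤k : 1 ≤ k) (large : g ℕ.+ p ℕ.+ k ℕ.+ k ≤ m)
           (valid : ValidPattern m k c) where

    private
      instance
        p+m-nonZero : NonZero (p ℕ.+ m)
        p+m-nonZero = ℕ.>-nonZero (ℕP.<-≤-trans (ℕ.>-nonZero⁻¹ m) (ℕP.m≤n+m m p))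

      g+k≤m : g ℕ.+ k ≤ m
      g+k≤m = ℕP.≤-trans (ℕP.≤-trans (ℕP.m≤m+n (g ℕ.+ k) (p ℕ.+ k)) (ℕP.≤-reflexive (rearrange g p k))) large
        where
        rearrange : ∀ g p k → g ℕ.+ k ℕ.+ (p ℕ.+ k) ≡ g ℕ.+ p ℕ.+ k ℕ.+ k
        rearrange = ℕ-Solver.solve-∀

      d≤m : ∀ {d} → d ≤ k → d ≤ m
      d≤m d≤k = ℕP.≤-trans d≤k (ℕP.m+n≤o⇒n≤o g g+k≤m)

      g≤m∸d : ∀ {d} → d ≤ k → g ≤ m ∸ d
      g≤m∸d d≤k = ℕP.m+n≤o⇒m≤o∸n g (ℕP.≤-trans (ℕP.+-monoʳ-≤ g d≤k) g+k≤m)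

      p≤j : ∀ {j} → m ≤ j ℕ.+ k → p ≤ j
      p≤j {j} m≤j+k = ℕP.+-cancelʳ-≤ k p j (ℕP.≤-trans p+k≤m m≤j+k)
        where
        rearrange : ∀ g p k → p ℕ.+ k ℕ.+ (g ℕ.+ k) ≡ g ℕ.+ p ℕ.+ k ℕ.+ k
        rearrange = ℕ-Solver.solve-∀
        p+k≤m : p ℕ.+ k ≤ m
        p+k≤m = ℕP.≤-trans (ℕP.≤-trans (ℕP.m≤m+n (p ℕ.+ k) (g ℕ.+ k)) (ℕP.≤-reflexive (rearrange g p k))) large

      d≤p+m : ∀ {d} → d ≤ k → d ≤ p ℕ.+ m
      d≤p+m d≤k = ℕP.m≤n⇒m≤o+n p (d≤m d≤k)

      module Low {j} (j+k<m : j ℕ.+ k < m) where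

        j<m : j < m
        j<m = ℕP.≤-<-trans (ℕP.m≤m+n j k) j+k<m

        forward : ∀ {d} → d ≤ k → c ((j ℕ.+ d) % (p ℕ.+ m)) ≡ c ((j ℕ.+ d) % m)
        forward d≤k = cong c (trans (m<n⇒m%n≡m (ℕP.<-≤-trans j+d<m (ℕP.m≤n+m m p))) (sym (m<n⇒m%n≡m j+d<m)))
          where j+d<m = ℕP.≤-<-trans (ℕP.+-monoʳ-≤ j d≤k) j+k<m

        backward : ∀ {d} → d ≤ k → c ((j ℕ.+ (p ℕ.+ m ∸ d)) % (p ℕ.+ m)) ≡ c ((j ℕ.+ (m ∸ d)) % m)
        backward {d} d≤k with d ≤? j
        ... | yes d≤j = cong c (trans (%-back-wrap d≤j (ℕP.<-≤-trans j<m (ℕP.m≤n+m m p)) (d≤p+m d≤k))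
                                      (sym (%-back-wrap d≤j j<m (d≤m d≤k))))
        ... | no d≰j = begin
          c ((j ℕ.+ (p ℕ.+ m ∸ d)) % (p ℕ.+ m))   ≡⟨ cong c (%-back-small j<d (d≤p+m d≤k)) ⟩
          c (j ℕ.+ (p ℕ.+ m ∸ d))                 ≡⟨ cong c shift ⟩
          c (p ℕ.+ (j ℕ.+ (m ∸ d)))               ≡⟨ periodic (j ℕ.+ (m ∸ d)) (ℕP.m≤n⇒m≤o+n j (g≤m∸d d≤k)) ⟩
          c (j ℕ.+ (m ∸ d))                       ≡⟨ cong c (%-back-small j<d (d≤m d≤k)) ⟨
          c ((j ℕ.+ (m ∸ d)) % m)                 ∎
          where
          open ≡-Reasoning
          j<d = ℕP.≰⇒> d≰j
          swap : ∀ j p x → j ℕ.+ (p ℕ.+ x) ≡ p ℕ.+ (j ℕ.+ x)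
          swap = ℕ-Solver.solve-∀
          shift : j ℕ.+ (p ℕ.+ m ∸ d) ≡ p ℕ.+ (j ℕ.+ (m ∸ d))
          shift = trans (cong (j ℕ.+_) (ℕP.+-∸-assoc p (d≤m d≤k))) (swap j p (m ∸ d))

        valid-low : ColumnValid (p ℕ.+ m) k c j
        valid-low = WindowValid-≡ refl (forward 1≤k) (backward 1≤k) (forward ℕP.≤-refl) (backward ℕP.≤-refl)
                                  (valid j<m)

      module High {j′} (m≤j+k : m ≤ p ℕ.+ j′ ℕ.+ k) (j<p+m : p ℕ.+ j′ < p ℕ.+ m) where

        j′<m : j′ < m
        j′<m = ℕP.+-cancelˡ-< p j′ m j<p+m

        g+k≤j′ : g ℕ.+ k ≤ j′
        g+k≤j′ = ℕP.+-cancelˡ-≤ (p ℕ.+ k) (g ℕ.+ k) j′ (begin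
          p ℕ.+ k ℕ.+ (g ℕ.+ k)   ≡⟨ rearrange₁ p k g ⟩
          g ℕ.+ p ℕ.+ k ℕ.+ k     ≤⟨ large ⟩
          m                       ≤⟨ m≤j+k ⟩
          p ℕ.+ j′ ℕ.+ k          ≡⟨ rearrange₂ p j′ k ⟩
          p ℕ.+ k ℕ.+ j′          ∎)
          where
          open ℕP.≤-Reasoning
          rearrange₁ : ∀ p k g → p ℕ.+ k ℕ.+ (g ℕ.+ k) ≡ g ℕ.+ p ℕ.+ k ℕ.+ k
          rearrange₁ = ℕ-Solver.solve-∀
          rearrange₂ : ∀ p j k → p ℕ.+ j ℕ.+ k ≡ p ℕ.+ k ℕ.+ j
          rearrange₂ = ℕ-Solver.solve-∀

        g+d≤j′ : ∀ {d} → d ≤ k → g ℕ.+ d ≤ j′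
        g+d≤j′ d≤k = ℕP.≤-trans (ℕP.+-monoʳ-≤ g d≤k) g+k≤j′

        backward : ∀ {d} → d ≤ k → c ((p ℕ.+ j′ ℕ.+ (p ℕ.+ m ∸ d)) % (p ℕ.+ m)) ≡ c ((j′ ℕ.+ (m ∸ d)) % m)
        backward {d} d≤k = begin
          c ((p ℕ.+ j′ ℕ.+ (p ℕ.+ m ∸ d)) % (p ℕ.+ m))
            ≡⟨ cong c (%-back-wrap (ℕP.m≤n⇒m≤o+n p d≤j′) j<p+m (d≤p+m d≤k)) ⟩
          c (p ℕ.+ j′ ∸ d)
            ≡⟨ cong c (ℕP.+-∸-assoc p d≤j′) ⟩
          c (p ℕ.+ (j′ ∸ d))
            ≡⟨ periodic (j′ ∸ d) (ℕP.m+n≤o⇒m≤o∸n g (g+d≤j′ d≤k)) ⟩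
          c (j′ ∸ d)
            ≡⟨ cong c (%-back-wrap d≤j′ j′<m (d≤m d≤k)) ⟨
          c ((j′ ℕ.+ (m ∸ d)) % m) ∎
          where
          open ≡-Reasoning
          d≤j′ = ℕP.m+n≤o⇒n≤o g (g+d≤j′ d≤k)

        forward : ∀ {d} → d ≤ k → c ((p ℕ.+ j′ ℕ.+ d) % (p ℕ.+ m)) ≡ c ((j′ ℕ.+ d) % m)
        forward {d} d≤k with j′ ℕ.+ d <? m
        ... | yes j′+d<m = begin
          c ((p ℕ.+ j′ ℕ.+ d) % (p ℕ.+ m))
            ≡⟨ cong (λ i → c (i % (p ℕ.+ m))) (ℕP.+-assoc p j′ d) ⟩
          c ((p ℕ.+ (j′ ℕ.+ d)) % (p ℕ.+ m))
            ≡⟨ cong c (m<n⇒m%n≡m (ℕP.+-monoʳ-< p j′+d<m)) ⟩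
          c (p ℕ.+ (j′ ℕ.+ d))
            ≡⟨ periodic (j′ ℕ.+ d) (ℕP.m≤n⇒m≤n+o d (ℕP.m+n≤o⇒m≤o g (g+d≤j′ d≤k))) ⟩
          c (j′ ℕ.+ d)
            ≡⟨ cong c (m<n⇒m%n≡m j′+d<m) ⟨
          c ((j′ ℕ.+ d) % m) ∎
          where open ≡-Reasoning
        ... | no j′+d≮m = cong c (begin
          (p ℕ.+ j′ ℕ.+ d) % (p ℕ.+ m)
            ≡⟨ cong (_% (p ℕ.+ m)) (ℕP.+-assoc p j′ d) ⟩
          (p ℕ.+ (j′ ℕ.+ d)) % (p ℕ.+ m)
            ≡⟨ %-wrap (ℕP.+-monoʳ-≤ p m≤j′+d) (ℕP.<-≤-trans (ℕP.+-monoʳ-< p j′+d<2m) p+2m≤2[p+m]) ⟩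
          p ℕ.+ (j′ ℕ.+ d) ∸ (p ℕ.+ m)
            ≡⟨ ℕP.[m+n]∸[m+o]≡n∸o p (j′ ℕ.+ d) m ⟩
          j′ ℕ.+ d ∸ m
            ≡⟨ %-wrap m≤j′+d j′+d<2m ⟨
          (j′ ℕ.+ d) % m ∎)
          where
          open ≡-Reasoning
          m≤j′+d = ℕP.≮⇒≥ j′+d≮m
          j′+d<2m = ℕP.+-mono-<-≤ j′<m (d≤m d≤k)
          p+2m≤2[p+m] : p ℕ.+ (m ℕ.+ m) ≤ p ℕ.+ m ℕ.+ (p ℕ.+ m)
          p+2m≤2[p+m] = ℕP.≤-trans (ℕP.≤-reflexive (sym (ℕP.+-assoc p m m)))
                                   (ℕP.+-monoʳ-≤ (p ℕ.+ m) (ℕP.m≤n+m m p))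

        valid-high : ColumnValid (p ℕ.+ m) k c (p ℕ.+ j′)
        valid-high = WindowValid-≡ (periodic j′ (ℕP.m+n≤o⇒m≤o g g+k≤j′)) (forward 1≤k) (backward 1≤k)
                                   (forward ℕP.≤-refl) (backward ℕP.≤-refl) (valid j′<m)

    -- One more period inserted into the periodic part: column j of the longer cycle sees the
    -- window of column j of the shorter one if j + k < m, and that of column j − p otherwise.
    extend : ∀ {n} .{{_ : NonZero n}} → n ≡ p ℕ.+ m → ValidPattern n k c
    extend refl {j} j<n with j ℕ.+ k <? m
    ... | yes j+k<m = Low.valid-low j+k<m
    ... | no j+k≮m with j ∸ p | ℕP.m+[n∸m]≡n (p≤j (ℕP.≮⇒≥ j+k≮m))
    ...   | j′ | refl = High.valid-high (ℕP.≮⇒≥ j+k≮m) j<n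

  ∑<-extend : ∀ {n} → g ≤ n →
              ∑< (p ℕ.+ n) (columnValue ∘ c) ≡ ∑< p (columnValue ∘ c ∘ (g ℕ.+_)) + ∑< n (columnValue ∘ c)
  ∑<-extend {n} g≤n with n ∸ g | ℕP.m+[n∸m]≡n g≤n
  ... | r | refl = begin
    ∑< (p ℕ.+ (g ℕ.+ r)) F                     ≡⟨ cong (λ n → ∑< n F) (swap p g r) ⟩
    ∑< (g ℕ.+ (p ℕ.+ r)) F                     ≡⟨ ∑<-+ g (p ℕ.+ r) F ⟩
    ∑< g F + ∑< (p ℕ.+ r) G                    ≡⟨ cong (_+_ (∑< g F)) (∑<-+ p r G) ⟩
    ∑< g F + (∑< p G + ∑< r (G ∘ (p ℕ.+_)))    ≡⟨ cong (λ s → ∑< g F + (∑< p G + s))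
                                                      (sum-cong-≗ {r} (G-periodic ∘ toℕ)) ⟩
    ∑< g F + (∑< p G + ∑< r G)                 ≡⟨ x∙yz≈y∙xz (∑< g F) (∑< p G) (∑< r G) ⟩
    ∑< p G + (∑< g F + ∑< r G)                 ≡⟨ cong (_+_ (∑< p G)) (∑<-+ g r F) ⟨
    ∑< p G + ∑< (g ℕ.+ r) F                    ∎
    where
    open ≡-Reasoning
    F = columnValue ∘ c
    G = F ∘ (g ℕ.+_)
    swap : ∀ x y z → x ℕ.+ (y ℕ.+ z) ≡ y ℕ.+ (x ℕ.+ z)
    swap = ℕ-Solver.solve-∀
    G-periodic : ∀ i → G (p ℕ.+ i) ≡ G i
    G-periodic i = trans (cong F (swap g p i)) (cong columnValue (periodic (g ℕ.+ i) (ℕP.m≤m+n g i)))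

  module Family {k c₀ e} .{{_ : NonZero c₀}} (1≤k : 1 ≤ k) (large : g ℕ.+ p ℕ.+ k ℕ.+ k ≤ c₀)
                (valid₀ : ValidPattern c₀ k c) (total₀ : ∑< c₀ (columnValue ∘ c) ≡ + (e ℕ.+ c₀))
                (block : ∑< p (columnValue ∘ c ∘ (g ℕ.+_)) ≡ + p) where

    family-valid : ∀ q → ValidPattern (q ℕ.* p ℕ.+ c₀) {{nonZero-+ (q ℕ.* p)}} k c
    family-valid ℕ.zero    = valid₀
    family-valid (ℕ.suc q) = extend {{nonZero-+ (q ℕ.* p)}} 1≤k
                               (ℕP.≤-trans large (ℕP.m≤n+m c₀ (q ℕ.* p))) (family-valid q)
                               {{nonZero-+ (ℕ.suc q ℕ.* p)}} (ℕP.+-assoc p (q ℕ.* p) c₀)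

    family-total : ∀ q → ∑< (q ℕ.* p ℕ.+ c₀) (columnValue ∘ c) ≡ + (e ℕ.+ (q ℕ.* p ℕ.+ c₀))
    family-total ℕ.zero    = total₀
    family-total (ℕ.suc q) = begin
      ∑< (p ℕ.+ q ℕ.* p ℕ.+ c₀) (columnValue ∘ c)
        ≡⟨ cong (λ n → ∑< n (columnValue ∘ c)) (ℕP.+-assoc p (q ℕ.* p) c₀) ⟩
      ∑< (p ℕ.+ (q ℕ.* p ℕ.+ c₀)) (columnValue ∘ c)
        ≡⟨ ∑<-extend (ℕP.≤-trans g≤c₀ (ℕP.m≤n+m c₀ (q ℕ.* p))) ⟩
      ∑< p (columnValue ∘ c ∘ (g ℕ.+_)) + ∑< (q ℕ.* p ℕ.+ c₀) (columnValue ∘ c)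
        ≡⟨ cong₂ _+_ block (family-total q) ⟩
      + p + + (e ℕ.+ (q ℕ.* p ℕ.+ c₀))
        ≡⟨ cong +_ (regroup p (q ℕ.* p) c₀ e) ⟩
      + (e ℕ.+ (p ℕ.+ q ℕ.* p ℕ.+ c₀)) ∎
      where
      open ≡-Reasoning
      regroup : ∀ p x c e → p ℕ.+ (e ℕ.+ (x ℕ.+ c)) ≡ e ℕ.+ (p ℕ.+ x ℕ.+ c)
      regroup = ℕ-Solver.solve-∀
      assoc : ∀ g p k → g ℕ.+ (p ℕ.+ k ℕ.+ k) ≡ g ℕ.+ p ℕ.+ k ℕ.+ k
      assoc = ℕ-Solver.solve-∀
      g≤c₀ = ℕP.≤-trans (ℕP.m≤m+n g (p ℕ.+ k ℕ.+ k)) (ℕP.≤-trans (ℕP.≤-reflexive (assoc g p k)) large)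

-- Column patterns for P(m,3)

alternating : ℕ → Column
alternating 0                   = L₋₁ , L₋₁
alternating 1                   = L₂ , L₂
alternating (ℕ.suc (ℕ.suc j)) = alternating j

twisted : ℕ → Column
twisted 0 = L₋₁ , L₂
twisted 1 = L₂ , L₋₁
twisted 2 = L₂ , L₋₁
twisted 3 = L₋₁ , L₂
twisted (ℕ.suc (ℕ.suc (ℕ.suc (ℕ.suc j)))) = twisted j

-- Patterns for m ≡ 1 and m ≡ 3 (mod 4).
twisted₁ : ℕ → Column
twisted₁ 0 = L₂ , L₁
twisted₁ 1 = L₋₁ , L₋₁
twisted₁ 2 = L₂ , L₁
twisted₁ j@(ℕ.suc (ℕ.suc (ℕ.suc _))) = twisted j

twisted₃ : ℕ → Column
twisted₃ 0 = L₁ , L₋₁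
twisted₃ 1 = L₋₁ , L₃
twisted₃ 2 = L₋₁ , L₂
twisted₃ 3 = L₂ , L₂
twisted₃ 4 = L₋₁ , L₋₁
twisted₃ 5 = L₂ , L₁
twisted₃ 6 = L₋₁ , L₋₁
twisted₃ 7 = L₂ , L₁
twisted₃ 8 = L₋₁ , L₂
twisted₃ (ℕ.suc (ℕ.suc (ℕ.suc (ℕ.suc (ℕ.suc (ℕ.suc (ℕ.suc (ℕ.suc (ℕ.suc j))))))))) = twisted j

twisted₁-periodic : ∀ x → 3 ≤ x → twisted₁ (4 ℕ.+ x) ≡ twisted₁ x
twisted₁-periodic _ (ℕ.s≤s (ℕ.s≤s (ℕ.s≤s _))) = refl

twisted₃-periodic : ∀ x → 9 ≤ x → twisted₃ (4 ℕ.+ x) ≡ twisted₃ x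
twisted₃-periodic _ (ℕ.s≤s (ℕ.s≤s (ℕ.s≤s (ℕ.s≤s (ℕ.s≤s (ℕ.s≤s (ℕ.s≤s (ℕ.s≤s (ℕ.s≤s _))))))))) = refl

module Alternating = Periodic alternating 2 0 (λ _ _ → refl)
module Twisted₁ = Periodic twisted₁ 4 3 twisted₁-periodic
module Twisted₃ = Periodic twisted₃ 4 9 twisted₃-periodic

open Alternating.Family {k = 3} {c₀ = 8} {e = 0} (ℕ.s≤s ℕ.z≤n) ℕP.≤-refl
  (from-yes (validPattern? 8 3 alternating)) refl refl
  renaming (family-valid to alternating-valid; family-total to alternating-total)
open Twisted₁.Family {k = 3} {c₀ = 13} {e = 1} (ℕ.s≤s ℕ.z≤n) ℕP.≤-refl
  (from-yes (validPattern? 13 3 twisted₁)) refl refl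
  renaming (family-valid to twisted₁-valid; family-total to twisted₁-total)
open Twisted₃.Family {k = 3} {c₀ = 19} {e = 1} (ℕ.s≤s ℕ.z≤n) ℕP.≤-refl
  (from-yes (validPattern? 19 3 twisted₃)) refl refl
  renaming (family-valid to twisted₃-valid; family-total to twisted₃-total)

data Shape : ℕ → Set where
  even    : ∀ q → Shape (q ℕ.* 2 ℕ.+ 8)
  odd₁    : ∀ q → Shape (q ℕ.* 4 ℕ.+ 13)
  odd₃    : ∀ q → Shape (q ℕ.* 4 ℕ.+ 19)
  nine    : Shape 9
  eleven  : Shape 11
  fifteen : Shape 15

shape-+4 : ∀ {n} → Shape n → Shape (4 ℕ.+ n)
shape-+4 (even q) = even (2 ℕ.+ q)
shape-+4 (odd₁ q) = odd₁ (ℕ.suc q)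
shape-+4 (odd₃ q) = odd₃ (ℕ.suc q)
shape-+4 nine     = odd₁ 0
shape-+4 eleven   = fifteen
shape-+4 fifteen  = odd₃ 0

shape : ∀ {m} → 8 ≤ m → Shape m
shape {m} 8≤m with m ∸ 8 | ℕP.m+[n∸m]≡n 8≤m
... | k | refl = go k
  where
  go : ∀ k → Shape (8 ℕ.+ k)
  go 0 = even 0
  go 1 = nine
  go 2 = even 1
  go 3 = eleven
  go (ℕ.suc (ℕ.suc (ℕ.suc (ℕ.suc k)))) = shape-+4 (go k)

[q*[t*2]+c]%2≡c%2 : ∀ q t c → (q ℕ.* (t ℕ.* 2) ℕ.+ c) % 2 ≡ c % 2
[q*[t*2]+c]%2≡c%2 q t c = begin
  (q ℕ.* (t ℕ.* 2) ℕ.+ c) % 2   ≡⟨ cong (_% 2) (ℕP.+-comm (q ℕ.* (t ℕ.* 2)) c) ⟩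
  (c ℕ.+ q ℕ.* (t ℕ.* 2)) % 2   ≡⟨ cong (λ x → (c ℕ.+ x) % 2) (ℕP.*-assoc q t 2) ⟨
  (c ℕ.+ q ℕ.* t ℕ.* 2) % 2     ≡⟨ [m+kn]%n≡m%n c (q ℕ.* t) 2 ⟩
  c % 2                         ∎
  where open ≡-Reasoning

module _ {m} (8≤m : 8 ≤ m) where

  private instance
    m-nonZero : NonZero m
    m-nonZero = ℕ.>-nonZero (ℕP.<-≤-trans (ℕ.s≤s ℕ.z≤n) 8≤m)

  open Cubic m 3 (ℕ.s≤s ℕ.z≤n) (ℕP.<⇒≤ 8≤m)

  γsdR-even : ∀ {c} → ValidPattern m 3 c → ∑< m (columnValue ∘ c) ≡ + m → Petersen.IsγsdR m 3 (+ m)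
  γsdR-even valid total = IsγsdR-from valid total weight-≥

  γsdR-odd : ∀ {c} → m % 2 ≡ 1 → ValidPattern m 3 c → ∑< m (columnValue ∘ c) ≡ + suc m →
             Petersen.IsγsdR m 3 (+ suc m)
  γsdR-odd odd valid total = IsγsdR-from valid total (λ sdrdf → weight-≥-odd sdrdf odd)

theorem5 : (m : ℕ) → .{{_ : NonZero m}} → 8 ≤ m →
    (m % 2 ≡ 0 → Petersen.IsγsdR m 3 (+ m))
    × (m % 2 ≡ 1 → Petersen.IsγsdR m 3 (+ suc m))
theorem5 m 8≤m with shape 8≤m
... | even q  = (λ _ → γsdR-even 8≤m (alternating-valid q) (alternating-total q))
              , (λ odd → ⊥-elim (ℕP.0≢1+n (trans (sym ([q*[t*2]+c]%2≡c%2 q 1 8)) odd)))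
... | odd₁ q  = (λ even → ⊥-elim (ℕP.1+n≢0 (trans (sym ([q*[t*2]+c]%2≡c%2 q 2 13)) even)))
              , (λ odd → γsdR-odd 8≤m odd (twisted₁-valid q) (twisted₁-total q))
... | odd₃ q  = (λ even → ⊥-elim (ℕP.1+n≢0 (trans (sym ([q*[t*2]+c]%2≡c%2 q 2 19)) even)))
              , (λ odd → γsdR-odd 8≤m odd (twisted₃-valid q) (twisted₃-total q))
... | nine    = (λ ()) , (λ odd → γsdR-odd 8≤m odd (from-yes (validPattern? 9 3 twisted₁)) refl)
... | eleven  = (λ ()) , (λ odd → γsdR-odd 8≤m odd (from-yes (validPattern? 11 3 twisted₃)) refl)
... | fifteen = (λ ()) , (λ odd → γsdR-odd 8≤m odd (from-yes (validPattern? 15 3 twisted₃)) refl)
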